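{- (Downwards closure) Let $F=(W,\sim)$ be a $\kappa$-frame, let $h$ be a history over $F$ and let $(w,U,v)$ be an element of $h$. If there exists $A\in U$ and a nonempty $B\subseteq A$, then $B\in U$.
   Context: Fix a finite set $\mathsf{Ag}$ of agents; an agent pattern is a set $G\subseteq\mathcal{P}(\mathsf{Ag})\setminus\{\emptyset\}$. A frame is a pair $F=(W,\sim)$ where $\sim$ assigns to each agent pattern $G$ a symmetric and transitive relation $\sim_G$ on $W$. Let $\mathsf{alive}(G)=\{w\mid w\sim_G w\}$. $F$ is a $\kappa$-frame if for all agent patterns $G,H$: (K1) $\mathsf{alive}(G)\cap\mathsf{alive}(H)\subseteq\mathsf{alive}(G\cup H)$; (K2) $\mathsf{alive}(G)\subseteq\mathsf{alive}(\{A\cup B\})$ for $A,B\in G$; (K3) $\sim_H\subseteq\sim_G$ if $G\subseteq H$; (K4) $\sim_G\subseteq\sim_{G\cup\{B\}}$ if some $A\in G$ has $\emptyset\ne B\subseteq A$; (NE) every $w$ has some $G$ with $w\sim_G w$. A history over $F$ is a nonempty finite sequence of triples $(w,G,v)$ such that for each triple $w\sim_G v$ and $G$ is maximal under set inclusion among agent patterns $G'$ with $w\sim_{G'}v$, and consecutive triples $(w,G,v),(w',G',v')$ satisfy $v=w'$. -}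

module Defs where

open import Data.Nat using (ℕ)
open import Data.Bool using (Bool; true; false; _∨_)
import Data.Bool as Bool
open import Data.Fin.Subset using (Subset; ⊥; _∪_; _⊆_; Nonempty)
open import Data.Vec.Properties using (≡-dec)
open import Data.Product using (Σ; ∃; _×_; _,_)
open import Data.List using (List)
open import Data.List.NonEmpty using (List⁺; toList)
open import Data.List.Relation.Unary.All using (All)
open import Data.List.Relation.Unary.Linked using (Linked)
open import Relation.Binary.PropositionalEquality using (_≡_)
open import Relation.Nullary.Decidable using (⌊_⌋)

-- The agents are Ag = Fin n.  A set of coalitions (subsets of Ag) is
-- represented by its characteristic function.
Pat : ℕ → Set
Pat n = Subset n → Bool

module _ {n : ℕ} where

  infix 4 _∈P_ _⊆P_

  _∈P_ : Subset n → Pat n → Set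
  A ∈P G = G A ≡ true

  _⊆P_ : Pat n → Pat n → Set
  G ⊆P H = ∀ A → A ∈P G → A ∈P H

  IsPattern : Pat n → Set
  IsPattern G = G ⊥ ≡ false

  _∪P_ : Pat n → Pat n → Pat n
  (G ∪P H) A = G A ∨ H A

  ｛_｝ : Subset n → Pat n
  ｛ A ｝ B = ⌊ ≡-dec Bool._≟_ B A ⌋

-- A frame: relations ∼_G indexed by agent patterns (values at non-patterns
-- are irrelevant: every condition below only concerns agent patterns).
record Frame (n : ℕ) : Set₁ where
  field
    W   : Set
    _∼[_]_ : W → Pat n → W → Set
    ∼-sym   : ∀ G → IsPattern G → ∀ {w v} → w ∼[ G ] v → v ∼[ G ] w
    ∼-trans : ∀ G → IsPattern G → ∀ {w v u} → w ∼[ G ] v → v ∼[ G ] u → w ∼[ G ] u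

  alive : Pat n → W → Set
  alive G w = w ∼[ G ] w

record IsKappaFrame {n : ℕ} (F : Frame n) : Set where
  open Frame F
  field
    K1 : ∀ G H → IsPattern G → IsPattern H →
         ∀ w → alive G w → alive H w → alive (G ∪P H) w
    K2 : ∀ G → IsPattern G → ∀ A B → A ∈P G → B ∈P G →
         ∀ w → alive G w → alive ｛ A ∪ B ｝ w
    K3 : ∀ G H → IsPattern G → IsPattern H → G ⊆P H →
         ∀ w v → w ∼[ H ] v → w ∼[ G ] v
    K4 : ∀ G → IsPattern G → ∀ A B → A ∈P G → Nonempty B → B ⊆ A →
         ∀ w v → w ∼[ G ] v → w ∼[ G ∪P ｛ B ｝ ] v
    NE : ∀ w → Σ (Pat n) λ G → IsPattern G × alive G w

module _ {n : ℕ} (F : Frame n) where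
  open Frame F

  Triple : Set
  Triple = W × Pat n × W

  GoodTriple : Triple → Set
  GoodTriple (w , G , v) =
    IsPattern G × w ∼[ G ] v ×
    (∀ G' → IsPattern G' → w ∼[ G' ] v → G ⊆P G' → G' ⊆P G)

  Consecutive : Triple → Triple → Set
  Consecutive (_ , _ , v) (w' , _ , _) = v ≡ w'

  record History : Set where
    field
      triples : List⁺ Triple
      good    : All GoodTriple (toList triples)
      linked  : Linked Consecutive (toList triples)

{-# OPTIONS --safe #-}
module Submission where

-- If (w, U, v) occurs in a history, then U is a maximal pattern relating w
-- and v.  By K4, w is still related to v under U ∪ {B}, which is again an
-- agent pattern since B is nonempty; maximality forces U ∪ {B} ⊆ U, so B ∈ U.

open import Defs
open import Data.Nat using (ℕ)
open import Data.Bool.Properties using (∨-zeroʳ)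
import Data.Bool as Bool
open import Data.Fin.Subset using (Subset; _∈_; _⊆_; Nonempty; ⊥)
open import Data.Fin.Subset.Properties using (∉⊥)
open import Data.Vec.Properties using (≡-dec)
open import Data.Product using (_,_)
open import Function using (_∘_)
open import Data.List.NonEmpty using (toList)
import Data.List.Membership.Propositional as List
import Data.List.Relation.Unary.All as All
open import Relation.Binary.PropositionalEquality using (_≢_; refl; sym; trans; cong₂; subst)
open import Relation.Nullary.Decidable using (isYes≗does; dec-true; dec-false)

module _ {n : ℕ} where

  nonempty⇒≢⊥ : {B : Subset n} → Nonempty B → B ≢ ⊥
  nonempty⇒≢⊥ (x , x∈B) B≡⊥ = ∉⊥ (subst (x ∈_) B≡⊥ x∈B)

  ∈P-｛｝ : (A : Subset n) → A ∈P ｛ A ｝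
  ∈P-｛｝ A = trans (isYes≗does A≟A) (dec-true A≟A refl)
    where A≟A = ≡-dec Bool._≟_ A A

  ｛｝-isPattern : {B : Subset n} → Nonempty B → IsPattern ｛ B ｝
  ｛｝-isPattern {B} neB = trans (isYes≗does ⊥≟B) (dec-false ⊥≟B (nonempty⇒≢⊥ neB ∘ sym))
    where ⊥≟B = ≡-dec Bool._≟_ ⊥ B

  ∪P-isPattern : (G H : Pat n) → IsPattern G → IsPattern H → IsPattern (G ∪P H)
  ∪P-isPattern _ _ G⊥≡false H⊥≡false = cong₂ Bool._∨_ G⊥≡false H⊥≡false

  ⊆P-∪Pˡ : (G H : Pat n) → G ⊆P G ∪P H
  ⊆P-∪Pˡ G H A A∈G rewrite A∈G = refl

  ∈P-∪Pʳ : (G H : Pat n) {A : Subset n} → A ∈P H → A ∈P G ∪P H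
  ∈P-∪Pʳ G H {A} A∈H rewrite A∈H = ∨-zeroʳ (G A)

module _ {n : ℕ} (F : Frame n) where
  open Frame F

  goodTriple-absorbs : ∀ {w U v} → GoodTriple F (w , U , v) →
                       ∀ H → IsPattern H → w ∼[ U ∪P H ] v → H ⊆P U
  goodTriple-absorbs {U = U} (U-pat , _ , U-maximal) H H-pat w∼v A A∈H =
    U-maximal (U ∪P H) (∪P-isPattern U H U-pat H-pat) w∼v (⊆P-∪Pˡ U H) A (∈P-∪Pʳ U H A∈H)

  goodTriple-downClosed : IsKappaFrame F → ∀ {w U v} → GoodTriple F (w , U , v) →
                          ∀ (A B : Subset n) → A ∈P U → Nonempty B → B ⊆ A →
                          B ∈P U
  goodTriple-downClosed K {w} {U} {v} good@(U-pat , w∼v , _) A B A∈U neB B⊆A =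
    goodTriple-absorbs good ｛ B ｝ (｛｝-isPattern neB)
      (IsKappaFrame.K4 K U U-pat A B A∈U neB B⊆A w v w∼v) B (∈P-｛｝ B)

lemma5p20 : {n : ℕ} (F : Frame n) → IsKappaFrame F →
            (h : History F) → ∀ w U v →
            (w , U , v) List.∈ toList (History.triples h) →
            ∀ (A B : Subset n) → A ∈P U → Nonempty B → B ⊆ A →
            B ∈P U
lemma5p20 F K h w U v mem =
  goodTriple-downClosed F K (All.lookup (History.good h) mem)
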